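{- Let $\gamma/\lambda$ and $\gamma'/\lambda'$ be skew shapes with $\gamma/\lambda\subseteq\gamma'/\lambda'$ (as sets of cells). Then ${}^\leftarrow\!\uparrow(\gamma/\lambda)\subseteq{}^\leftarrow\!\uparrow(\gamma'/\lambda')$, and hence ${}^\leftarrow\!\uparrow(\gamma/\lambda)\le_{GDom}{}^\leftarrow\!\uparrow(\gamma'/\lambda')$.
   Context: For partitions $\lambda\subseteq\gamma$ (with $\lambda$ padded by zeros), the skew shape $\gamma/\lambda$ is the set of cells $(i,j)$ (row $i$ from the top, column $j$ from the left) with $\lambda_i<j\le\gamma_i$. The top-left standardization ${}^\leftarrow\!\uparrow(\gamma/\lambda)$ is the transpose (conjugate) of the partition $(c_1,c_2,\ldots,c_k)$ obtained by listing the numbers of cells in the columns of $\gamma/\lambda$ in non-increasing order; equivalently its $i$-th part is the number of columns of $\gamma/\lambda$ with at least $i$ cells. For partitions, $\alpha\subseteq\beta$ means $\alpha_i\le\beta_i$ for all $i$. Generalized dominance order: for a partition $\alpha=(\alpha_1,\ldots,\alpha_k)$ of $n$ and a partition $\beta=(\beta_1,\ldots,\beta_l)$ of $m$ with $n\le m$, $\alpha\le_{GDom}\beta$ means $\alpha_1+\cdots+\alpha_i\le\beta_1+\cdots+\beta_i$ for all $1\le i\le\min\{k,l\}$. -}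

module Defs where

open import Data.Nat using (ℕ; zero; suc; _≤_; _<_; _≥_; _≤?_; _<?_)
open import Data.List using (List; []; _∷_; length; filter; map; upTo; take)
open import Data.Nat.ListAction using (sum)
open import Data.List.Relation.Unary.Linked using (Linked)
open import Data.Product using (_×_)
open import Relation.Nullary.Decidable using (_×-dec_)

-- A partition: a weakly decreasing list of naturals (trailing zeros allowed,
-- read as padding).
IsPartition : List ℕ → Set
IsPartition xs = Linked (λ a b → b ≤ a) xs

-- i-th part (rows indexed from 0), padded by zeros.
part : List ℕ → ℕ → ℕ
part []       _       = 0
part (x ∷ xs) zero    = x
part (x ∷ xs) (suc i) = part xs i

_⊆ₚ_ : List ℕ → List ℕ → Set
α ⊆ₚ β = ∀ i → part α i ≤ part β i

-- Cell (i , j) (row i counted from 0, column j counted from 1) lies in γ/λ.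
InSkew : List ℕ → List ℕ → ℕ → ℕ → Set
InSkew γ λ' i j = (part λ' i < j) × (j ≤ part γ i)

SkewSub : List ℕ → List ℕ → List ℕ → List ℕ → Set
SkewSub γ λ' γ' λ'' = ∀ i j → InSkew γ λ' i j → InSkew γ' λ'' i j

-- Number of cells of γ/λ in column j (all cells lie in rows < length γ).
colLen : List ℕ → List ℕ → ℕ → ℕ
colLen γ λ' j =
  length (filter (λ i → (part λ' i <? j) ×-dec (j ≤? part γ i)) (upTo (length γ)))

columns : List ℕ → List ℕ
columns γ = map suc (upTo (part γ 0))

-- Number of columns of γ/λ with at least k cells
-- (= k-th part of the conjugate of the sorted column-length partition).
stdPart : List ℕ → List ℕ → ℕ → ℕ
stdPart γ λ' k = length (filter (λ j → k ≤? colLen γ λ' j) (columns γ))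

-- Top-left standardization of γ/λ, as the list of its (positive) parts.
-- Column lengths are at most length γ, so parts k = 1 .. length γ suffice;
-- the sequence is non-increasing, so dropping zeros keeps exactly the positive parts.
std : List ℕ → List ℕ → List ℕ
std γ λ' = filter (λ x → 1 ≤? x) (map (λ k → stdPart γ λ' (suc k)) (upTo (length γ)))

_≤GDom_ : List ℕ → List ℕ → Set
α ≤GDom β = (sum α ≤ sum β)
  × (∀ i → 1 ≤ i → i ≤ length α → i ≤ length β → sum (take i α) ≤ sum (take i β))

-- Every cell of γ/λ is a cell of γ'/λ', so each column of γ/λ is at most as long as the
-- same column of γ'/λ'.  Hence for every k at least as many columns of γ'/λ' as of γ/λ
-- have k or more cells; that count is the k-th part of the standardization, giving
-- containment, and partwise containment gives every prefix-sum inequality of dominance.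
module Submission where

open import Defs
open import Data.Nat using (ℕ; zero; suc; _+_; _≤_; _<_; z≤n; s≤s; s≤s⁻¹; _≤?_; _<?_)
open import Data.Nat.Properties
open import Data.List using (List; []; _∷_; [_]; length; filter; map; upTo; take; applyUpTo; _++_)
open import Data.List.Properties using (applyUpTo-∷ʳ; map-upTo; filter-++; length-++; length-filter; length-upTo)
open import Data.Nat.ListAction using (sum)
open import Data.List.Relation.Unary.Linked using ([]; [-]; _∷_; tail)
open import Data.Product using (_×_; _,_; proj₂; ∃-syntax)
open import Data.Bool using (true; false)
open import Data.Sum using (inj₁; inj₂)
open import Level using (Level)
open import Relation.Nullary using (yes; no; does; contradiction; _×-dec_)
open import Relation.Unary using (Pred; Decidable)
open import Relation.Binary.PropositionalEquality using (_≡_; refl; sym; trans; cong; module ≡-Reasoning)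
open import Function using (_∘_; id)

private
  variable
    a p q : Level
    A : Set a
    P : Pred ℕ p
    Q : Pred ℕ q
    m n : ℕ

countBelow : Decidable P → ℕ → ℕ
countBelow P? zero = 0
countBelow P? (suc n) with does (P? n)
... | true  = suc (countBelow P? n)
... | false = countBelow P? n

countBelow-suc : {P : Pred A p} (P? : Decidable P) (f : ℕ → A) (n : ℕ) →
  countBelow (P? ∘ f) (suc n) ≡ countBelow (P? ∘ f) n + length (filter P? [ f n ])
countBelow-suc P? f n with does (P? (f n))
... | true  = +-comm 1 _
... | false = sym (+-identityʳ _)

length-filter-applyUpTo : {P : Pred A p} (P? : Decidable P) (f : ℕ → A) (n : ℕ) →
  length (filter P? (applyUpTo f n)) ≡ countBelow (P? ∘ f) n
length-filter-applyUpTo P? f zero = refl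
length-filter-applyUpTo P? f (suc n) = begin
  length (filter P? (applyUpTo f (suc n)))
    ≡⟨ cong (length ∘ filter P?) (applyUpTo-∷ʳ f n) ⟨
  length (filter P? (applyUpTo f n ++ [ f n ]))
    ≡⟨ cong length (filter-++ P? (applyUpTo f n) [ f n ]) ⟩
  length (filter P? (applyUpTo f n) ++ filter P? [ f n ])
    ≡⟨ length-++ (filter P? (applyUpTo f n)) ⟩
  length (filter P? (applyUpTo f n)) + length (filter P? [ f n ])
    ≡⟨ cong (_+ length (filter P? [ f n ])) (length-filter-applyUpTo P? f n) ⟩
  countBelow (P? ∘ f) n + length (filter P? [ f n ])
    ≡⟨ countBelow-suc P? f n ⟨
  countBelow (P? ∘ f) (suc n) ∎
  where open ≡-Reasoning

countBelow-accept : (P? : Decidable P) → P n → countBelow P? (suc n) ≡ suc (countBelow P? n)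
countBelow-accept {n = n} P? Pn with P? n
... | yes _  = refl
... | no ¬Pn = contradiction Pn ¬Pn

countBelow-≤-suc : (P? : Decidable P) (n : ℕ) → countBelow P? n ≤ countBelow P? (suc n)
countBelow-≤-suc P? n with does (P? n)
... | true  = n≤1+n _
... | false = ≤-refl

countBelow-monoʳ-≤ : (P? : Decidable P) → m ≤ n → countBelow P? m ≤ countBelow P? n
countBelow-monoʳ-≤ {n = zero} P? z≤n = ≤-refl
countBelow-monoʳ-≤ {n = suc n} P? m≤1+n with m≤n⇒m<n∨m≡n m≤1+n
... | inj₁ m<1+n = ≤-trans (countBelow-monoʳ-≤ P? (s≤s⁻¹ m<1+n)) (countBelow-≤-suc P? n)
... | inj₂ refl  = ≤-refl

countBelow-mono : (P? : Decidable P) (Q? : Decidable Q) (m n : ℕ) →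
  (∀ {i} → i < m → P i → i < n × Q i) → countBelow P? m ≤ countBelow Q? n
countBelow-mono P? Q? zero    n P⇒Q = z≤n
countBelow-mono {P = P} {Q = Q} P? Q? (suc m) n P⇒Q with P? m
... | no _   = countBelow-mono P? Q? m n (P⇒Q ∘ m<n⇒m<1+n)
... | yes Pm with P⇒Q ≤-refl Pm
...   | m<n , Qm = begin
  suc (countBelow P? m)  ≤⟨ s≤s (countBelow-mono P? Q? m m P⇒Q-below-m) ⟩
  suc (countBelow Q? m)  ≡⟨ countBelow-accept Q? Qm ⟨
  countBelow Q? (suc m)  ≤⟨ countBelow-monoʳ-≤ Q? m<n ⟩
  countBelow Q? n        ∎
  where
  open ≤-Reasoning
  P⇒Q-below-m : ∀ {i} → i < m → P i → i < m × Q i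
  P⇒Q-below-m i<m Pi = i<m , P⇒Q (m<n⇒m<1+n i<m) Pi .proj₂

countBelow-witness : (P? : Decidable P) (n : ℕ) → 0 < countBelow P? n → ∃[ i ] i < n × P i
countBelow-witness P? (suc n) pos with P? n
... | yes Pn = n , ≤-refl , Pn
... | no _ with countBelow-witness P? n pos
...   | i , i<n , Pi = i , m<n⇒m<1+n i<n , Pi

part-≤-part₀ : ∀ {xs} → IsPartition xs → ∀ i → part xs i ≤ part xs 0
part-≤-part₀ []                   i       = z≤n
part-≤-part₀ [-]                  zero    = ≤-refl
part-≤-part₀ [-]                  (suc i) = z≤n
part-≤-part₀ (_ ∷ _)              zero    = ≤-refl
part-≤-part₀ (y≤x ∷ ys-partition) (suc i) = ≤-trans (part-≤-part₀ ys-partition i) y≤x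

part-pos⇒<length : ∀ xs i → 0 < part xs i → i < length xs
part-pos⇒<length (x ∷ xs) zero    _   = s≤s z≤n
part-pos⇒<length (x ∷ xs) (suc i) pos = s≤s (part-pos⇒<length xs i pos)

applyUpTo-isPartition : (h : ℕ → ℕ) → (∀ i → h (suc i) ≤ h i) → ∀ n → IsPartition (applyUpTo h n)
applyUpTo-isPartition h anti zero          = []
applyUpTo-isPartition h anti (suc zero)    = [-]
applyUpTo-isPartition h anti (suc (suc n)) = anti 0 ∷ applyUpTo-isPartition (h ∘ suc) (anti ∘ suc) (suc n)

part-applyUpTo : (h : ℕ → ℕ) (n : ℕ) → (∀ i → n ≤ i → h i ≡ 0) → ∀ i → part (applyUpTo h n) i ≡ h i
part-applyUpTo h zero    vanish i       = sym (vanish i z≤n)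
part-applyUpTo h (suc n) vanish zero    = refl
part-applyUpTo h (suc n) vanish (suc i) = part-applyUpTo (h ∘ suc) n (λ i n≤i → vanish (suc i) (s≤s n≤i)) i

part-filter-positive : ∀ {xs} → IsPartition xs → ∀ i → part (filter (1 ≤?_) xs) i ≡ part xs i
part-filter-positive {[]}         _            i       = refl
part-filter-positive {suc x ∷ xs} xs-partition zero    = refl
part-filter-positive {suc x ∷ xs} xs-partition (suc i) = part-filter-positive (tail xs-partition) i
part-filter-positive {zero ∷ xs}  xs-partition i       = begin
  part (filter (1 ≤?_) xs) i  ≡⟨ part-filter-positive (tail xs-partition) i ⟩
  part xs i                   ≡⟨ vanishes (suc i) ⟩
  0                           ≡⟨ vanishes i ⟨
  part (zero ∷ xs) i          ∎
  where
  open ≡-Reasoning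
  vanishes : ∀ j → part (zero ∷ xs) j ≡ 0
  vanishes j = n≤0⇒n≡0 (part-≤-part₀ xs-partition j)

inColumn? : (γ λ₀ : List ℕ) (j : ℕ) → Decidable (λ i → InSkew γ λ₀ i j)
inColumn? γ λ₀ j i = (part λ₀ i <? j) ×-dec (j ≤? part γ i)

longColumn? : (γ λ₀ : List ℕ) (k : ℕ) → Decidable (λ j → k ≤ colLen γ λ₀ j)
longColumn? γ λ₀ k j = k ≤? colLen γ λ₀ j

InSkew⇒<length : ∀ γ λ₀ {i j} → InSkew γ λ₀ i j → i < length γ
InSkew⇒<length γ λ₀ {i} (λ<j , j≤γ) = part-pos⇒<length γ i (<-≤-trans (≤-<-trans z≤n λ<j) j≤γ)

colLen≡countBelow : ∀ γ λ₀ j → colLen γ λ₀ j ≡ countBelow (inColumn? γ λ₀ j) (length γ)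
colLen≡countBelow γ λ₀ j = length-filter-applyUpTo (inColumn? γ λ₀ j) id (length γ)

colLen-≤-length : ∀ γ λ₀ j → colLen γ λ₀ j ≤ length γ
colLen-≤-length γ λ₀ j =
  ≤-trans (length-filter (inColumn? γ λ₀ j) (upTo (length γ))) (≤-reflexive (length-upTo (length γ)))

colLen-pos⇒cell : ∀ γ λ₀ j → 0 < colLen γ λ₀ j → ∃[ i ] InSkew γ λ₀ i j
colLen-pos⇒cell γ λ₀ j pos
  with countBelow-witness (inColumn? γ λ₀ j) (length γ) (≤-trans pos (≤-reflexive (colLen≡countBelow γ λ₀ j)))
... | i , _ , cell = i , cell

colLen-mono : ∀ γ λ₀ γ' λ₀' → SkewSub γ λ₀ γ' λ₀' → ∀ j → colLen γ λ₀ j ≤ colLen γ' λ₀' j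
colLen-mono γ λ₀ γ' λ₀' sub j = begin
  colLen γ λ₀ j                                ≡⟨ colLen≡countBelow γ λ₀ j ⟩
  countBelow (inColumn? γ λ₀ j) (length γ)     ≤⟨ countBelow-mono _ _ (length γ) (length γ') cell⇒cell ⟩
  countBelow (inColumn? γ' λ₀' j) (length γ')  ≡⟨ colLen≡countBelow γ' λ₀' j ⟨
  colLen γ' λ₀' j                              ∎
  where
  open ≤-Reasoning
  cell⇒cell : ∀ {i} → i < length γ → InSkew γ λ₀ i j → i < length γ' × InSkew γ' λ₀' i j
  cell⇒cell {i} _ cell = InSkew⇒<length γ' λ₀' (sub i j cell) , sub i j cell

stdPart≡countBelow : ∀ γ λ₀ k → stdPart γ λ₀ k ≡ countBelow (longColumn? γ λ₀ k ∘ suc) (part γ 0)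
stdPart≡countBelow γ λ₀ k =
  trans (cong (length ∘ filter (longColumn? γ λ₀ k)) (map-upTo suc (part γ 0)))
        (length-filter-applyUpTo (longColumn? γ λ₀ k) suc (part γ 0))

stdPart-mono : ∀ γ λ₀ γ' λ₀' → IsPartition γ' → SkewSub γ λ₀ γ' λ₀' →
  ∀ k → stdPart γ λ₀ (suc k) ≤ stdPart γ' λ₀' (suc k)
stdPart-mono γ λ₀ γ' λ₀' γ'-partition sub k = begin
  stdPart γ λ₀ (suc k)                                       ≡⟨ stdPart≡countBelow γ λ₀ (suc k) ⟩
  countBelow (longColumn? γ λ₀ (suc k) ∘ suc) (part γ 0)     ≤⟨ countBelow-mono _ _ (part γ 0) (part γ' 0) long⇒long ⟩
  countBelow (longColumn? γ' λ₀' (suc k) ∘ suc) (part γ' 0)  ≡⟨ stdPart≡countBelow γ' λ₀' (suc k) ⟨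
  stdPart γ' λ₀' (suc k)                                     ∎
  where
  open ≤-Reasoning
  long⇒long : ∀ {j} → j < part γ 0 → suc k ≤ colLen γ λ₀ (suc j) →
              j < part γ' 0 × suc k ≤ colLen γ' λ₀' (suc j)
  long⇒long {j} _ long with colLen-pos⇒cell γ λ₀ (suc j) (≤-trans (s≤s z≤n) long)
  ... | i , cell = ≤-trans (sub i (suc j) cell .proj₂) (part-≤-part₀ γ'-partition i)
                 , ≤-trans long (colLen-mono γ λ₀ γ' λ₀' sub (suc j))

stdPart-antitone : ∀ γ λ₀ k → stdPart γ λ₀ (suc (suc k)) ≤ stdPart γ λ₀ (suc k)
stdPart-antitone γ λ₀ k = begin
  stdPart γ λ₀ (suc (suc k))                                    ≡⟨ stdPart≡countBelow γ λ₀ (suc (suc k)) ⟩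
  countBelow (longColumn? γ λ₀ (suc (suc k)) ∘ suc) (part γ 0)
    ≤⟨ countBelow-mono _ _ (part γ 0) (part γ 0) (λ j<γ₀ long → j<γ₀ , <⇒≤ long) ⟩
  countBelow (longColumn? γ λ₀ (suc k) ∘ suc) (part γ 0)        ≡⟨ stdPart≡countBelow γ λ₀ (suc k) ⟨
  stdPart γ λ₀ (suc k)                                          ∎
  where open ≤-Reasoning

stdPart-vanishes : ∀ γ λ₀ k → length γ ≤ k → stdPart γ λ₀ (suc k) ≡ 0
stdPart-vanishes γ λ₀ k γ≤k = n≤0⇒n≡0 (begin
  stdPart γ λ₀ (suc k)                                    ≡⟨ stdPart≡countBelow γ λ₀ (suc k) ⟩
  countBelow (longColumn? γ λ₀ (suc k) ∘ suc) (part γ 0)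
    ≤⟨ countBelow-mono _ (longColumn? γ λ₀ (suc k) ∘ suc) (part γ 0) 0 tooLong ⟩
  0                                                       ∎)
  where
  open ≤-Reasoning
  tooLong : ∀ {j} → j < part γ 0 → suc k ≤ colLen γ λ₀ (suc j) → j < 0 × suc k ≤ colLen γ λ₀ (suc j)
  tooLong {j} _ long = contradiction (≤-trans long (colLen-≤-length γ λ₀ (suc j))) (<⇒≱ (s≤s γ≤k))

-- Dropping zeros and stopping at length γ are harmless: the counts are non-increasing in k
-- and vanish once k exceeds length γ, since no column is longer than that.
part-std : ∀ γ λ₀ i → part (std γ λ₀) i ≡ stdPart γ λ₀ (suc i)
part-std γ λ₀ i = begin
  part (filter (1 ≤?_) (map (stdPart γ λ₀ ∘ suc) (upTo (length γ)))) i
    ≡⟨ cong (λ xs → part (filter (1 ≤?_) xs) i) (map-upTo (stdPart γ λ₀ ∘ suc) (length γ)) ⟩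
  part (filter (1 ≤?_) (applyUpTo (stdPart γ λ₀ ∘ suc) (length γ))) i
    ≡⟨ part-filter-positive (applyUpTo-isPartition _ (stdPart-antitone γ λ₀) (length γ)) i ⟩
  part (applyUpTo (stdPart γ λ₀ ∘ suc) (length γ)) i
    ≡⟨ part-applyUpTo _ (length γ) (stdPart-vanishes γ λ₀) i ⟩
  stdPart γ λ₀ (suc i) ∎
  where open ≡-Reasoning

std-mono : ∀ γ λ₀ γ' λ₀' → IsPartition γ' → SkewSub γ λ₀ γ' λ₀' → std γ λ₀ ⊆ₚ std γ' λ₀'
std-mono γ λ₀ γ' λ₀' γ'-partition sub i = begin
  part (std γ λ₀) i       ≡⟨ part-std γ λ₀ i ⟩
  stdPart γ λ₀ (suc i)    ≤⟨ stdPart-mono γ λ₀ γ' λ₀' γ'-partition sub i ⟩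
  stdPart γ' λ₀' (suc i)  ≡⟨ part-std γ' λ₀' i ⟨
  part (std γ' λ₀') i     ∎
  where open ≤-Reasoning

sum-mono-⊆ₚ : ∀ α β → α ⊆ₚ β → sum α ≤ sum β
sum-mono-⊆ₚ []      β       α⊆β = z≤n
sum-mono-⊆ₚ (a ∷ α) []      α⊆β = +-mono-≤ (α⊆β 0) (sum-mono-⊆ₚ α [] (α⊆β ∘ suc))
sum-mono-⊆ₚ (a ∷ α) (b ∷ β) α⊆β = +-mono-≤ (α⊆β 0) (sum-mono-⊆ₚ α β (α⊆β ∘ suc))

part-take-≤ : ∀ n xs j → part (take n xs) j ≤ part xs j
part-take-≤ zero    xs       j       = z≤n
part-take-≤ (suc n) []       j       = z≤n
part-take-≤ (suc n) (x ∷ xs) zero    = ≤-refl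
part-take-≤ (suc n) (x ∷ xs) (suc j) = part-take-≤ n xs j

take-mono-⊆ₚ : ∀ n α β → α ⊆ₚ β → take n α ⊆ₚ take n β
take-mono-⊆ₚ zero    α       β       α⊆β j       = z≤n
take-mono-⊆ₚ (suc n) []      β       α⊆β j       = z≤n
take-mono-⊆ₚ (suc n) (a ∷ α) []      α⊆β zero    = α⊆β 0
take-mono-⊆ₚ (suc n) (a ∷ α) []      α⊆β (suc j) = ≤-trans (part-take-≤ n α j) (α⊆β (suc j))
take-mono-⊆ₚ (suc n) (a ∷ α) (b ∷ β) α⊆β zero    = α⊆β 0
take-mono-⊆ₚ (suc n) (a ∷ α) (b ∷ β) α⊆β (suc j) = take-mono-⊆ₚ n α β (α⊆β ∘ suc) j

⊆ₚ⇒≤GDom : ∀ α β → α ⊆ₚ β → α ≤GDom β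
⊆ₚ⇒≤GDom α β α⊆β =
  sum-mono-⊆ₚ α β α⊆β , λ i _ _ _ → sum-mono-⊆ₚ (take i α) (take i β) (take-mono-⊆ₚ i α β α⊆β)

lemma4p1 : (γ λ₀ γ' λ₀' : List ℕ) →
    IsPartition γ → IsPartition λ₀ → IsPartition γ' → IsPartition λ₀' →
    λ₀ ⊆ₚ γ → λ₀' ⊆ₚ γ' →
    SkewSub γ λ₀ γ' λ₀' →
    (std γ λ₀ ⊆ₚ std γ' λ₀') × (std γ λ₀ ≤GDom std γ' λ₀')
lemma4p1 γ λ₀ γ' λ₀' _ _ γ'-partition _ _ _ sub =
  std⊆std' , ⊆ₚ⇒≤GDom (std γ λ₀) (std γ' λ₀') std⊆std'
  where
  std⊆std' : std γ λ₀ ⊆ₚ std γ' λ₀'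
  std⊆std' = std-mono γ λ₀ γ' λ₀' γ'-partition sub
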